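{- Let $q\ge2$, let $S$ be a $q$-constellation and $G=\Psi^{ -1}(S)$. Let $w$ be a white vertex of $S$ which is incident to an edge $e$ such that $e$ is a bridge of $S$ and the connected component of $S\setminus e$ not containing $w$ is a tree not containing the root white vertex. Then $w$ is admissible.
   Context: A $(q+1)$-edge-colored graph is a finite connected multigraph with edge colors in $\{0,\dots,q\}$, each vertex incident to exactly one edge of each color; rooted = one color-$0$ edge distinguished and oriented; bipartite = vertices black/white with every edge joining black to white (origin of root edge black). A $q$-constellation is a connected graph with white vertices, each of degree $q$ with one incident edge of each color $1,\dots,q$, and colored vertices, each carrying a color $i\in\{1,\dots,q\}$ and a cyclic order of its incident edges; each edge has a color $i$ and joins a white vertex to a color-$i$ vertex; one white vertex is the root. The bijection $\Psi$ from rooted bipartite colored graphs to $q$-constellations: orient all edges black to white; contract every color-$0$ edge, merging its endpoints into a white vertex (the root edge giving the root); for each $i$ the color-$i$ edges form disjoint directed cycles; replace each such cycle on $p$ vertices by a new color-$i$ vertex joined by color-$i$ edges to these $p$ vertices in the cyclic order of the cycle. The two vertices of $G$ corresponding to a white vertex $w$ of $S$ are the endpoints of the color-$0$ edge contracted into $w$. The white vertex $w$ is admissible if these two vertices are joined in $G$ by a path containing no color-$0$ edge. -}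

module Defs where

open import Data.Nat using (ℕ; zero; suc; _≤ᵇ_)
open import Data.Fin using (Fin; toℕ)
open import Data.Bool using (Bool; true; false; not; if_then_else_)
open import Data.List using (List; []; _∷_; foldr; upTo)
open import Data.List.Relation.Unary.All using (All)
open import Data.List.Relation.Unary.Unique.Propositional using (Unique)
open import Data.Product using (Σ; _×_; _,_; Σ-syntax)
open import Data.Sum using (_⊎_)
open import Data.Unit using (⊤)
open import Relation.Binary.PropositionalEquality using (_≡_; _≢_)

record Graph : Set₁ where
  field
    V    : Set
    E    : Set
    ends : E → V × V

module _ (Γ : Graph) where
  open Graph Γ

  Link : E → V → V → Set
  Link e x y = (ends e ≡ (x , y)) ⊎ (ends e ≡ (y , x))

  data Walk : V → V → Set where
    nil  : ∀ {x} → Walk x x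
    cons : ∀ {x y z} (e : E) → Link e x y → Walk y z → Walk x z

  edgesOf : ∀ {x y} → Walk x y → List E
  edgesOf nil          = []
  edgesOf (cons e _ p) = e ∷ edgesOf p

  ConnectedWithout : E → V → V → Set
  ConnectedWithout e x y = Σ (Walk x y) (λ p → All (_≢ e) (edgesOf p))

  CycleWithout : E → V → Set
  CycleWithout e x =
    Σ (Walk x x) (λ p → (edgesOf p ≢ []) × Unique (edgesOf p) × All (_≢ e) (edgesOf p))

  IsBridge : E → Set
  IsBridge e = let (u , v) = ends e in ConnectedWithout e u v → Data.Empty.⊥
    where import Data.Empty

  ComponentIsTree : E → V → Set
  ComponentIsTree e x = ∀ y → ConnectedWithout e x y → CycleWithout e y → Data.Empty.⊥
    where import Data.Empty

-- Rooted bipartite (q+1)-edge-colored graphs.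
-- Colour c edges = perfect matching given by a fixed-point-free involution σ c.
-- Black = true.

data ReachBy {q n : ℕ} (σ : Fin (suc q) → Fin n → Fin n) (P : Fin (suc q) → Set)
  : Fin n → Fin n → Set where
  here : ∀ {x} → ReachBy σ P x x
  step : ∀ {x y} (c : Fin (suc q)) → P c → ReachBy σ P (σ c x) y → ReachBy σ P x y

record RBCGraph (q : ℕ) : Set where
  field
    n         : ℕ
    σ         : Fin (suc q) → Fin n → Fin n
    invol     : ∀ c v → σ c (σ c v) ≡ v
    colour    : Fin n → Bool
    flips     : ∀ c v → colour (σ c v) ≡ not (colour v)
    connected : ∀ x y → ReachBy σ (λ _ → ⊤) x y
    -- root edge = colour-0 edge {root , σ 0 root}, oriented from the black root
    root      : Fin n
    rootBlk   : colour root ≡ true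

-- vertices of S = Ψ(G): white vertices (indexed by black vertices of G,
-- i.e. by colour-0 edges) and coloured vertices (colour i+1, indexed by
-- the leader of the corresponding cycle; non-leader indices are isolated dummies)
data SVertex (q n : ℕ) : Set where
  white   : Fin n → SVertex q n
  colored : Fin q → Fin n → SVertex q n

module _ {q : ℕ} (G : RBCGraph q) where
  open RBCGraph G
  open import Data.Fin using (zero; suc)

  -- contracted color-(i+1) directed cycles on black vertices: b ↦ σ 0 (σ (i+1) b)
  π : Fin q → Fin n → Fin n
  π i b = σ zero (σ (suc i) b)

  iter : ℕ → (Fin n → Fin n) → Fin n → Fin n
  iter zero    f x = x
  iter (suc k) f x = f (iter k f x)

  minF : Fin n → Fin n → Fin n
  minF a b = if toℕ a ≤ᵇ toℕ b then a else b

  leader : Fin q → Fin n → Fin n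
  leader i b = foldr (λ k acc → minF (iter k (π i) b) acc) b (upTo n)

  -- edges of S: at each white vertex (black b of G) one edge of colour i+1
  SEdge : Set
  SEdge = (Σ[ b ∈ Fin n ] colour b ≡ true) × Fin q

  Ψ : Graph
  Ψ = record
    { V = SVertex q n
    ; E = SEdge
    ; ends = λ { ((b , _) , i) → (white b , colored i (leader i b)) }
    }

  Admissible : Fin n → Set
  Admissible b = ReachBy σ (λ c → c ≢ zero) b (σ zero b)

module Submission where

-- Let e₀ join w to its colour-i vertex c₀, beyond which S is a tree. In G, going around the
-- colour-(j+1) cycle through (the black vertex of) a white vertex x meets the colour-0 edges of all white
-- vertices at the colour-j vertex of x; so x is admissible as soon as every other white vertex y at that
-- colour-j vertex is: cross each edge {y, σ₀ y} by a path avoiding colour 0. Seen from w, each such y lies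
-- deeper in the tree and, as q ≥ 2, has an edge of another colour leading deeper still. Induction from the
-- leaves of the tree, starting at w itself with c₀, therefore makes w admissible. Depth is measured by
-- trails to c₀, which acyclicity and the bridge property let us extend at every step; a trail has at most
-- nq edges.

open import Defs
open import Axiom.UniquenessOfIdentityProofs using (module Decidable⇒UIP)
open import Data.Bool using (true; false; not; T)
open import Data.Bool.Properties using (not-involutive) renaming (_≟_ to _≟ᵇ_)
open import Data.Empty using (⊥; ⊥-elim)
open import Data.Fin using (Fin; toℕ; punchIn; combine) renaming (zero to fzero; suc to fsuc)
open import Data.Fin.Properties
  using (toℕ-injective; toℕ≤pred[n]; punchInᵢ≢i; pigeonhole; combine-injectiveˡ; combine-injectiveʳ)
  renaming (_≟_ to _≟ᶠ_)
open import Data.List using (List; []; _∷_; _++_; length; head; lookup; foldr; upTo)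
open import Data.List.Properties using (++-assoc; ++-identityʳ)
open import Data.List.Membership.Propositional using (_∈_; _∉_)
open import Data.List.Membership.Propositional.Properties using (∈-++⁻; ∈-++⁺ˡ; ∈-++⁺ʳ; ∈-lookup; ∈-upTo⁺)
open import Data.List.Relation.Unary.All as All using (All; []; _∷_)
open import Data.List.Relation.Unary.All.Properties using (++⁺; ++⁻ˡ; ¬Any⇒All¬)
open import Data.List.Relation.Unary.AllPairs using ([]; _∷_)
open import Data.List.Relation.Unary.Any using (here; there)
open import Data.List.Relation.Unary.Unique.Propositional using (Unique)
open import Data.Maybe using (just)
open import Data.Maybe.Properties using (just-injective)
open import Data.Nat using (ℕ; zero; suc; _+_; _*_; _≤_; _<_; _≤ᵇ_; _≤?_; s≤s)
open import Data.Nat.DivMod using (_%_; _/_; m%n<n; m≡m%n+[m/n]*n)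
open import Data.Nat.Properties
  using (≤-refl; ≤-trans; ≤-antisym; <⇒≤; <⇒≱; ≰⇒>; ≤ᵇ⇒≤; ≤⇒≤ᵇ; <-≤-trans;
         +-suc; m≤m+n; m≤n+m; n≤1+n; n<1+n; m≤n⇒∃[o]m+o≡n)
open import Data.Product using (Σ; ∃; ∃₂; _×_; _,_; proj₁; proj₂)
open import Data.Product.Properties using (,-injectiveˡ; ,-injectiveʳ)
open import Data.Sum using (_⊎_; inj₁; inj₂; [_,_]′)
open import Data.Unit using (tt)
open import Function using (id; _∘_)
open import Relation.Binary.PropositionalEquality
  using (_≡_; _≢_; refl; sym; trans; cong; subst; module ≡-Reasoning)
open import Relation.Nullary using (¬_; yes; no)

Unique-++⁻ˡ : ∀ {A : Set} (xs : List A) {ys : List A} → Unique (xs ++ ys) → Unique xs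
Unique-++⁻ˡ []       _           = []
Unique-++⁻ˡ (x ∷ xs) (x∉ ∷ uniq) = ++⁻ˡ xs x∉ ∷ Unique-++⁻ˡ xs uniq

Unique-lookup-< : ∀ {A : Set} {xs : List A} → Unique xs → (i j : Fin (length xs)) → toℕ i < toℕ j →
  lookup xs i ≢ lookup xs j
Unique-lookup-< (x∉xs ∷ _) fzero    (fsuc j) _         = All.lookup x∉xs (∈-lookup j)
Unique-lookup-< (_ ∷ uniq) (fsuc i) (fsuc j) (s≤s i<j) = Unique-lookup-< uniq i j i<j

Unique-length-≤ : ∀ {A : Set} {m} (enc : A → Fin m) → (∀ {a b} → enc a ≡ enc b → a ≡ b) →
  ∀ {xs} → Unique xs → length xs ≤ m
Unique-length-≤ {m = m} enc enc-injective {xs} uniq with length xs ≤? m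
... | yes ≤m = ≤m
... | no  ≰m with pigeonhole (≰⇒> ≰m) (λ k → enc (lookup xs k))
...   | i , j , i<j , eq = ⊥-elim (Unique-lookup-< uniq i j i<j (enc-injective eq))

Fin-another : ∀ {q} → 2 ≤ q → (j : Fin q) → ∃ λ j′ → j′ ≢ j
Fin-another (s≤s (s≤s _)) j = punchIn j fzero , punchInᵢ≢i j fzero

module _ {q n : ℕ} {σ : Fin (suc q) → Fin n → Fin n} {P : Fin (suc q) → Set} where

  ReachBy-trans : ∀ {x y z} → ReachBy σ P x y → ReachBy σ P y z → ReachBy σ P x z
  ReachBy-trans here         r′ = r′
  ReachBy-trans (step c p r) r′ = step c p (ReachBy-trans r r′)

  ReachBy-sym : (∀ c v → σ c (σ c v) ≡ v) → ∀ {x y} → ReachBy σ P x y → ReachBy σ P y x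
  ReachBy-sym invol here             = here
  ReachBy-sym invol {x} (step c p r) =
    ReachBy-trans (ReachBy-sym invol r) (step c p (subst (λ w → ReachBy σ P w x) (sym (invol c x)) here))

module Walks (Γ : Graph) where
  open Graph Γ

  private
    variable
      e h h′ : E
      x y z u v : V

  Link-sym : Link Γ e x y → Link Γ e y x
  Link-sym (inj₁ p) = inj₂ p
  Link-sym (inj₂ p) = inj₁ p

  Link-ends : Link Γ e x y → Link Γ e u v → (u ≡ x × v ≡ y) ⊎ (u ≡ y × v ≡ x)
  Link-ends (inj₁ p) (inj₁ q) = inj₁ (,-injectiveˡ (trans (sym q) p) , ,-injectiveʳ (trans (sym q) p))
  Link-ends (inj₁ p) (inj₂ q) = inj₂ (,-injectiveʳ (trans (sym q) p) , ,-injectiveˡ (trans (sym q) p))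
  Link-ends (inj₂ p) (inj₁ q) = inj₂ (,-injectiveˡ (trans (sym q) p) , ,-injectiveʳ (trans (sym q) p))
  Link-ends (inj₂ p) (inj₂ q) = inj₁ (,-injectiveʳ (trans (sym q) p) , ,-injectiveˡ (trans (sym q) p))

  _++ʷ_ : Walk Γ x y → Walk Γ y z → Walk Γ x z
  nil        ++ʷ q = q
  cons e l p ++ʷ q = cons e l (p ++ʷ q)

  edgesOf-++ʷ : (p : Walk Γ x y) (q : Walk Γ y z) → edgesOf Γ (p ++ʷ q) ≡ edgesOf Γ p ++ edgesOf Γ q
  edgesOf-++ʷ nil          q = refl
  edgesOf-++ʷ (cons e l p) q = cong (e ∷_) (edgesOf-++ʷ p q)

  reverseʷ : Walk Γ x y → Walk Γ y x
  reverseʷ nil          = nil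
  reverseʷ (cons e l p) = reverseʷ p ++ʷ cons e (Link-sym l) nil

  All-reverseʷ : {P : E → Set} (p : Walk Γ x y) → All P (edgesOf Γ p) → All P (edgesOf Γ (reverseʷ p))
  All-reverseʷ nil          []         = []
  All-reverseʷ (cons e l p) (pe ∷ pes) =
    subst (All _) (sym (edgesOf-++ʷ (reverseʷ p) _)) (++⁺ (All-reverseʷ p pes) (pe ∷ []))

  ConnectedWithout-sym : ConnectedWithout Γ e x y → ConnectedWithout Γ e y x
  ConnectedWithout-sym (p , avoid) = reverseʷ p , All-reverseʷ p avoid

  split-at : (p : Walk Γ x y) → h ∈ edgesOf Γ p →
    ∃₂ λ u v → Σ (Walk Γ x u) λ p₁ → Link Γ h u v × Σ (Walk Γ v y) λ p₂ →
      edgesOf Γ p ≡ edgesOf Γ p₁ ++ h ∷ edgesOf Γ p₂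
  split-at (cons e l p) (here refl) = _ , _ , nil , l , p , refl
  split-at (cons e l p) (there h∈p) with split-at p h∈p
  ... | u , v , p₁ , l′ , p₂ , eq = u , v , cons e l p₁ , l′ , p₂ , cong (e ∷_) eq

  record Trail (e : E) (x y : V) : Set where
    constructor trail
    field
      walk   : Walk Γ x y
      unique : Unique (edgesOf Γ walk)
      avoids : All (_≢ e) (edgesOf Γ walk)

  open Trail public

  Trail⇒ConnectedWithout : Trail e x y → ConnectedWithout Γ e x y
  Trail⇒ConnectedWithout T = walk T , avoids T

  closed-prefix⇒Cycle : (T : Trail e x y) (c : Walk Γ x x) {rest : List E} →
    edgesOf Γ c ≢ [] → edgesOf Γ (walk T) ≡ edgesOf Γ c ++ rest → CycleWithout Γ e x
  closed-prefix⇒Cycle T c c≢[] eq =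
    c , c≢[] , Unique-++⁻ˡ (edgesOf Γ c) (subst Unique eq (unique T))
             , ++⁻ˡ (edgesOf Γ c) (subst (All _) eq (avoids T))

  route : Trail e x y → List E
  route {e = e} T = edgesOf Γ (walk T) ++ e ∷ []

  extend : (T : Trail e y z) → Link Γ h x y → h ∉ route T → Trail e x z
  extend {h = h} T l h∉ = trail (cons h l (walk T))
    (¬Any⇒All¬ _ (λ h∈ → h∉ (∈-++⁺ˡ h∈)) ∷ unique T)
    ((λ h≡e → h∉ (∈-++⁺ʳ _ (here h≡e))) ∷ avoids T)

  module _ {e : E} (bridge : IsBridge Γ e) (tree : ComponentIsTree Γ e (proj₂ (ends e))) where

    no-cycle-at-start : Trail e y (proj₂ (ends e)) → CycleWithout Γ e y → ⊥
    no-cycle-at-start T = tree _ (ConnectedWithout-sym (Trail⇒ConnectedWithout T))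

    -- A second use of an edge at the start of T would close a cycle in the tree, or reach the near
    -- endpoint of the bridge without crossing it.
    ∈-route⇒head : (T : Trail e y (proj₂ (ends e))) → Link Γ h y z → h ∈ route T → head (route T) ≡ just h
    ∈-route⇒head {h = h} T l h∈ with ∈-++⁻ (edgesOf Γ (walk T)) h∈
    ... | inj₂ (here refl) = at-e T l
      where
        closed : (T : Trail e (proj₂ (ends e)) (proj₂ (ends e))) → head (route T) ≡ just e
        closed (trail nil _ _)             = refl
        closed T@(trail (cons _ _ _) _ _) =
          ⊥-elim (no-cycle-at-start T (closed-prefix⇒Cycle T (walk T) (λ ()) (sym (++-identityʳ _))))

        at-e : (T : Trail e x (proj₂ (ends e))) → Link Γ e x u → head (route T) ≡ just e
        at-e T (inj₁ p) = ⊥-elim (bridge (subst (λ w → ConnectedWithout Γ e w _) (sym (cong proj₁ p))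
                                                (Trail⇒ConnectedWithout T)))
        at-e T (inj₂ p) with sym (cong proj₂ p)
        ... | refl = closed T
    ... | inj₁ h∈T with split-at (walk T) h∈T
    ...   | _ , _ , nil , _ , _ , eq = cong (λ es → head (es ++ e ∷ [])) eq
    ...   | _ , _ , p₁@(cons _ _ _) , l′ , p₂ , eq with Link-ends l l′
    ...     | inj₁ (refl , refl) = ⊥-elim (no-cycle-at-start T (closed-prefix⇒Cycle T p₁ (λ ()) eq))
    ...     | inj₂ (refl , refl) =
                ⊥-elim (no-cycle-at-start T (closed-prefix⇒Cycle T (p₁ ++ʷ cons h l′ nil) (λ ()) eq′))
      where
        eq′ : edgesOf Γ (walk T) ≡ edgesOf Γ (p₁ ++ʷ cons h l′ nil) ++ edgesOf Γ p₂
        eq′ = trans eq (trans (sym (++-assoc (edgesOf Γ p₁) (h ∷ []) _))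
                              (cong (_++ edgesOf Γ p₂) (sym (edgesOf-++ʷ p₁ (cons h l′ nil)))))

    ∉-route : (T : Trail e y (proj₂ (ends e))) → Link Γ h y z → head (route T) ≡ just h′ → h ≢ h′ → h ∉ route T
    ∉-route T l first h≢h′ h∈ = h≢h′ (just-injective (trans (sym (∈-route⇒head T l h∈)) first))

module Orbits {q : ℕ} (G : RBCGraph q) where
  open RBCGraph G

  private
    variable
      f : Fin n → Fin n
      x y : Fin n
      j : Fin q

  σ-injective : ∀ c → σ c x ≡ σ c y → x ≡ y
  σ-injective {x} {y} c eq = trans (sym (invol c x)) (trans (cong (σ c) eq) (invol c y))

  π-injective : ∀ j → π G j x ≡ π G j y → x ≡ y
  π-injective j eq = σ-injective (fsuc j) (σ-injective fzero eq)

  colour-π : ∀ j x → colour (π G j x) ≡ colour x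
  colour-π j x = trans (flips fzero _) (trans (cong not (flips (fsuc j) x)) (not-involutive (colour x)))

  iter-comm : ∀ k → iter G k f (f x) ≡ f (iter G k f x)
  iter-comm zero    = refl
  iter-comm {f} (suc k) = cong f (iter-comm k)

  iter-+ : ∀ a b → iter G (a + b) f x ≡ iter G a f (iter G b f x)
  iter-+ zero    b = refl
  iter-+ {f} (suc a) b = cong f (iter-+ a b)

  iter-π-injective : ∀ k → iter G k (π G j) x ≡ iter G k (π G j) y → x ≡ y
  iter-π-injective zero    eq = eq
  iter-π-injective {j} (suc k) eq = iter-π-injective k (π-injective j eq)

  iter-periodic : ∀ d → iter G d f x ≡ x → ∀ r → iter G (r * d) f x ≡ x
  iter-periodic d per zero    = refl
  iter-periodic {f} {x} d per (suc r) = begin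
    iter G (d + r * d) f x        ≡⟨ iter-+ d (r * d) ⟩
    iter G d f (iter G (r * d) f x) ≡⟨ cong (iter G d f) (iter-periodic d per r) ⟩
    iter G d f x                  ≡⟨ per ⟩
    x                             ∎
    where open ≡-Reasoning

  colour-iter : ∀ k x → colour (iter G k (π G j) x) ≡ colour x
  colour-iter zero    x = refl
  colour-iter {j} (suc k) x = trans (colour-π j _) (colour-iter k x)

  -- Pigeonhole on the n + 1 points x, π x, …, πⁿ x; cancelling the common prefix gives the period.
  π-period : ∀ j x → ∃ λ d → iter G (suc d) (π G j) x ≡ x × suc d ≤ n
  π-period j x with pigeonhole (n<1+n n) (λ k → iter G (toℕ k) (π G j) x)
  ... | a , c , a<c , eq with m≤n⇒∃[o]m+o≡n a<c
  ...   | d , a+1+d≡c = d , iter-π-injective (toℕ a) returns , d+1≤n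
    where
      a+[1+d]≡c : toℕ a + suc d ≡ toℕ c
      a+[1+d]≡c = trans (+-suc (toℕ a) d) a+1+d≡c

      returns : iter G (toℕ a) (π G j) (iter G (suc d) (π G j) x) ≡ iter G (toℕ a) (π G j) x
      returns = trans (sym (iter-+ (toℕ a) (suc d)))
                      (trans (cong (λ k → iter G k (π G j) x) a+[1+d]≡c) (sym eq))

      d+1≤n : suc d ≤ n
      d+1≤n = ≤-trans (subst (suc d ≤_) a+[1+d]≡c (m≤n+m (suc d) (toℕ a))) (toℕ≤pred[n] c)

  minF-sel : ∀ a b → minF G a b ≡ a ⊎ minF G a b ≡ b
  minF-sel a b with toℕ a ≤ᵇ toℕ b
  ... | true  = inj₁ refl
  ... | false = inj₂ refl

  minF-≤ˡ : ∀ a b → toℕ (minF G a b) ≤ toℕ a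
  minF-≤ˡ a b with toℕ a ≤ᵇ toℕ b in a≰b
  ... | true  = ≤-refl
  ... | false = <⇒≤ (≰⇒> (λ a≤b → subst T a≰b (≤⇒≤ᵇ a≤b)))

  minF-≤ʳ : ∀ a b → toℕ (minF G a b) ≤ toℕ b
  minF-≤ʳ a b with toℕ a ≤ᵇ toℕ b in a≤b
  ... | true  = ≤ᵇ⇒≤ (toℕ a) (toℕ b) (subst T (sym a≤b) tt)
  ... | false = ≤-refl

  module _ (j : Fin q) (x : Fin n) where
    private
      minStep : ℕ → Fin n → Fin n
      minStep k acc = minF G (iter G k (π G j) x) acc

      foldr-minStep-iterate : ∀ ks → ∃ λ k → foldr minStep x ks ≡ iter G k (π G j) x
      foldr-minStep-iterate []       = 0 , refl
      foldr-minStep-iterate (k ∷ ks) with minF-sel (iter G k (π G j) x) (foldr minStep x ks)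
      ... | inj₁ eq = k , eq
      ... | inj₂ eq = let k′ , eq′ = foldr-minStep-iterate ks in k′ , trans eq eq′

      foldr-minStep-≤ : ∀ ks → All (λ k → toℕ (foldr minStep x ks) ≤ toℕ (iter G k (π G j) x)) ks
      foldr-minStep-≤ []       = []
      foldr-minStep-≤ (k ∷ ks) =
        minF-≤ˡ _ _ ∷ All.map (≤-trans (minF-≤ʳ (iter G k (π G j) x) _)) (foldr-minStep-≤ ks)

    leader-iterate : ∃ λ k → leader G j x ≡ iter G k (π G j) x
    leader-iterate = foldr-minStep-iterate (upTo n)

    leader-≤-iterate-< : ∀ k → k < n → toℕ (leader G j x) ≤ toℕ (iter G k (π G j) x)
    leader-≤-iterate-< k k<n = All.lookup (foldr-minStep-≤ (upTo n)) (∈-upTo⁺ k<n)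

    -- leader only minimises over the first n iterates, so reduce k modulo the period (at most n).
    leader-≤-iterate : ∀ k → toℕ (leader G j x) ≤ toℕ (iter G k (π G j) x)
    leader-≤-iterate k with π-period j x
    ... | d , per , d+1≤n = subst (λ y → toℕ (leader G j x) ≤ toℕ y) reduce
                                  (leader-≤-iterate-< (k % suc d) (<-≤-trans (m%n<n k (suc d)) d+1≤n))
      where
        open ≡-Reasoning
        reduce : iter G (k % suc d) (π G j) x ≡ iter G k (π G j) x
        reduce = begin
          iter G (k % suc d) (π G j) x
            ≡⟨ cong (iter G (k % suc d) (π G j)) (sym (iter-periodic {f = π G j} (suc d) per (k / suc d))) ⟩
          iter G (k % suc d) (π G j) (iter G (k / suc d * suc d) (π G j) x)
            ≡⟨ sym (iter-+ (k % suc d) _) ⟩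
          iter G (k % suc d + k / suc d * suc d) (π G j) x
            ≡⟨ cong (λ k′ → iter G k′ (π G j) x) (sym (m≡m%n+[m/n]*n k (suc d))) ⟩
          iter G k (π G j) x
            ∎

  leader-π : ∀ j x → leader G j (π G j x) ≡ leader G j x
  leader-π j x = toℕ-injective (≤-antisym leader-πx≤ ≤leader-πx)
    where
      open ≡-Reasoning
      leader-πx≤ : toℕ (leader G j (π G j x)) ≤ toℕ (leader G j x)
      leader-πx≤ with leader-iterate j x | π-period j x
      ... | k , eq | d , per , _ = subst (λ y → toℕ (leader G j (π G j x)) ≤ toℕ y) around
                                         (leader-≤-iterate j (π G j x) (k + d))
        where
          around : iter G (k + d) (π G j) (π G j x) ≡ leader G j x
          around = begin
            iter G (k + d) (π G j) (π G j x)     ≡⟨ iter-comm (k + d) ⟩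
            iter G (suc (k + d)) (π G j) x       ≡⟨ cong (λ k′ → iter G k′ (π G j) x) (sym (+-suc k d)) ⟩
            iter G (k + suc d) (π G j) x         ≡⟨ iter-+ k (suc d) ⟩
            iter G k (π G j) (iter G (suc d) (π G j) x) ≡⟨ cong (iter G k (π G j)) per ⟩
            iter G k (π G j) x                   ≡⟨ sym eq ⟩
            leader G j x                         ∎

      ≤leader-πx : toℕ (leader G j x) ≤ toℕ (leader G j (π G j x))
      ≤leader-πx with leader-iterate j (π G j x)
      ... | k , eq = subst (λ y → toℕ (leader G j x) ≤ toℕ y) (sym (trans eq (iter-comm k)))
                           (leader-≤-iterate j x (suc k))

  leader-iter : ∀ k x → leader G j (iter G k (π G j) x) ≡ leader G j x
  leader-iter zero    x = refl
  leader-iter {j} (suc k) x = trans (leader-π j _) (leader-iter k x)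

  -- σ₀ (π y) = σ_{j+1} y: one edge of colour j + 1.
  across-colour : ∀ j y → ReachBy σ (_≢ fzero) y (σ fzero (π G j y))
  across-colour j y = step (fsuc j) (λ ()) (subst (ReachBy σ _ (σ (fsuc j) y)) (sym (invol fzero _)) here)

  admissible-by-cycle : ∀ j x → (∀ k → iter G k (π G j) x ≢ x → Admissible G (iter G k (π G j) x)) →
    Admissible G x
  admissible-by-cycle j x admissible-on-cycle with π-period j x
  ... | d , per , _ = [ id , subst (λ y → ReachBy σ (_≢ fzero) x (σ fzero y)) per ]′ (around d)
    where
      around : ∀ k → Admissible G x ⊎ ReachBy σ (_≢ fzero) x (σ fzero (iter G (suc k) (π G j) x))
      around zero = inj₂ (across-colour j x)
      around (suc k) with around k
      ... | inj₁ adm = inj₁ adm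
      ... | inj₂ r with iter G (suc k) (π G j) x ≟ᶠ x
      ...   | yes returned = inj₁ (subst (λ y → ReachBy σ (_≢ fzero) x (σ fzero y)) returned r)
      ...   | no ¬returned = inj₂ (ReachBy-trans r (ReachBy-trans
                               (ReachBy-sym invol (admissible-on-cycle (suc k) ¬returned)) (across-colour j _)))

  SEdge-encode : SEdge G → Fin (n * q)
  SEdge-encode ((b , _) , j) = combine b j

  SEdge-encode-injective : ∀ {f g} → SEdge-encode f ≡ SEdge-encode g → f ≡ g
  SEdge-encode-injective {(b , bB) , j} {(b′ , bB′) , j′} eq
    with combine-injectiveˡ b j b′ j′ eq | combine-injectiveʳ b j b′ j′ eq
  ... | refl | refl = cong (λ bB″ → (b , bB″) , j) (Decidable⇒UIP.≡-irrelevant _≟ᵇ_ bB bB′)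

  Unique-SEdge-length-≤ : ∀ {fs : List (SEdge G)} → Unique fs → length fs ≤ n * q
  Unique-SEdge-length-≤ = Unique-length-≤ SEdge-encode SEdge-encode-injective

module BeyondBridge {q : ℕ} (2≤q : 2 ≤ q) (G : RBCGraph q)
  (b : Fin (RBCGraph.n G)) (bB : RBCGraph.colour G b ≡ true) (i : Fin q)
  (bridge : IsBridge (Ψ G) ((b , bB) , i))
  (tree : ComponentIsTree (Ψ G) ((b , bB) , i) (colored i (leader G i b))) where
  open RBCGraph G
  open Orbits G
  open Walks (Ψ G)

  e₀ : SEdge G
  e₀ = (b , bB) , i

  c₀ : SVertex q n
  c₀ = colored i (leader G i b)

  -- The colour-j vertex of x lies deeper than x: the trail T from it to c₀, continued across e₀ to w,
  -- starts with the edge (x, j).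
  admissible-beyond : (fuel : ℕ) (x : Fin n) (xB : colour x ≡ true) (j : Fin q)
    (T : Trail e₀ (colored j (leader G j x)) c₀) → head (route T) ≡ just ((x , xB) , j) →
    n * q < fuel + length (edgesOf (Ψ G) (walk T)) → Admissible G x
  admissible-beyond zero       x xB j T _     long = ⊥-elim (<⇒≱ long (Unique-SEdge-length-≤ (unique T)))
  admissible-beyond (suc fuel) x xB j T first long = admissible-by-cycle j x admissible-sibling
    where
      admissible-sibling : ∀ k → iter G k (π G j) x ≢ x → Admissible G (iter G k (π G j) x)
      admissible-sibling k y≢x = admissible-beyond fuel y yB j′ T₂ refl longer
        where
          y : Fin n
          y = iter G k (π G j) x

          yB : colour y ≡ true
          yB = trans (colour-iter k x) xB

          j′ : Fin q
          j′ = proj₁ (Fin-another 2≤q j)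

          parent child : SEdge G
          parent = (y , yB) , j
          child  = (y , yB) , j′

          same-vertex : colored j (leader G j y) ≡ colored j (leader G j x)
          same-vertex = cong (colored j) (leader-iter k x)

          up : Link (Ψ G) parent (white y) (colored j (leader G j x))
          up = inj₁ (cong (white y ,_) same-vertex)

          up⁻¹ : Link (Ψ G) parent (colored j (leader G j x)) (white y)
          up⁻¹ = inj₂ (cong (white y ,_) same-vertex)

          down : Link (Ψ G) child (colored j′ (leader G j′ y)) (white y)
          down = inj₂ refl

          down⁻¹ : Link (Ψ G) child (white y) (colored j′ (leader G j′ y))
          down⁻¹ = inj₁ refl

          T₁ : Trail e₀ (white y) c₀
          T₁ = extend {h = parent} T up
                 (∉-route bridge tree T up⁻¹ first (λ eq → y≢x (cong (proj₁ ∘ proj₁) eq)))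

          T₂ : Trail e₀ (colored j′ (leader G j′ y)) c₀
          T₂ = extend {h = child} T₁ down
                 (∉-route bridge tree T₁ down⁻¹ refl (λ eq → proj₂ (Fin-another 2≤q j) (cong proj₂ eq)))

          longer : n * q < fuel + length (edgesOf (Ψ G) (walk T₂))
          longer = <-≤-trans long (subst (suc fuel + length (edgesOf (Ψ G) (walk T)) ≤_)
                     (sym (trans (+-suc fuel _) (cong suc (+-suc fuel _)))) (n≤1+n _))

lemma4p4 : (q : ℕ) → 2 ≤ q → (G : RBCGraph q) →
    (b : Fin (RBCGraph.n G)) (bBlack : RBCGraph.colour G b ≡ true) (i : Fin q) →
    IsBridge (Ψ G) ((b , bBlack) , i) →
    ComponentIsTree (Ψ G) ((b , bBlack) , i) (colored i (leader G i b)) →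
    ¬ ConnectedWithout (Ψ G) ((b , bBlack) , i) (colored i (leader G i b)) (white (RBCGraph.root G)) →
    Admissible G b
lemma4p4 q 2≤q G b bB i bridge tree _ =
  admissible-beyond (suc (n * q)) b bB i (trail nil [] []) refl (m≤m+n (suc (n * q)) 0)
  where
    open RBCGraph G using (n)
    open Walks (Ψ G) using (trail)
    open BeyondBridge 2≤q G b bB i bridge tree
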